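{- Let $f_1,\dots,f_n$ be a structural equation model over Boolean variables $X_1,\dots,X_n$ (with $X_i=f_i(X_1,\dots,X_{i-1})$) and let $E$ be an effect set of valuations such that the default valuation belongs to $E$. Let $X$ be a but-for-cause for $E$, and let $C_X$ be the set of all nodes of the associated transition system $\mathcal{T}$ that are reached by a $\mathsf{default}$-transition assigning a value to a variable in $X$. Then $C_X$ is a $d_{\mathit{Hamm}}$-counterfactual cause for $\Diamond E$ in $\mathcal{T}$ on the default path $\pi$.
   Context: The default valuation is $v_1,\dots,v_n$ with $v_i=f_i(v_1,\dots,v_{i-1})$. A but-for-cause for $E$ is a minimal subset $X\subseteq\{X_1,\dots,X_n\}$ such that there are values $\alpha_x$ ($x\in X$) for which the valuation $w_1,\dots,w_n$, defined by $w_i=\alpha_{X_i}$ if $X_i\in X$ and $w_i=f_i(w_1,\dots,w_{i-1})$ otherwise, is not in $E$. The associated transition system $\mathcal{T}$ is a tree: nodes at level $i$ ($1\le i\le n+1$) are valuations of $X_1,\dots,X_{i-1}$, the root (initial state) being the empty valuation. From a node $s$ at level $i\le n$, the action $\mathsf{default}$ leads to the node extending $s$ by $X_i=f_i(\text{values in }s)$, and the action $\mathsf{intervention}$ leads to the node extending $s$ by the other value of $X_i$. Nodes reached by $\mathsf{intervention}$ are labeled $\{\mathsf{intervention}\}$, all other nodes (including the root) are labeled $\emptyset$. The effect $E$ is identified with the set of leaves whose valuation is in $E$. The default path $\pi$ always takes $\mathsf{default}$. Paths are maximal root-to-leaf paths, all of length $n+1$; $d_{\mathit{Hamm}}(\pi,\rho)$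 is the number of positions at which the traces (label sequences) of $\pi$ and $\rho$ differ. For a distance $d$, $C$ is a $d$-counterfactual cause for $\Diamond E$ on $\pi$ (where $\pi$ visits $C$ and reaches $E$) if some maximal path avoids $C$ and every maximal path avoiding $C$ with minimal $d$-distance to $\pi$ among such paths does not reach $E$. -}

module Defs where

open import Data.Bool using (Bool; true; false; not; if_then_else_)
open import Data.Nat using (ℕ; zero; suc; _≤_)
open import Data.Fin using (Fin; zero; suc; toℕ)
open import Data.Fin.Subset using (Subset; _∈_; _⊂_)
open import Data.Vec using (Vec; []; _∷_; _∷ʳ_; map; replicate)
open import Data.Product using (Σ; ∃; _×_; _,_)
open import Relation.Nullary using (¬_)
open import Relation.Unary using (Pred)
open import Level using (0ℓ)

-- Structural equation model over Boolean variables X_1..X_n: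
-- the equation of variable number i (0-based, i.e. X_{i+1}) takes the
-- values of the preceding variables (in order) and returns its value.
SEM : ℕ → Set
SEM n = (i : Fin n) → Vec Bool (toℕ i) → Bool

shiftSEM : ∀ {n} → SEM (suc n) → Bool → SEM n
shiftSEM f b i v = f (suc i) (b ∷ v)

Valuation : ℕ → Set
Valuation n = Vec Bool n

Effect : ℕ → Set₁
Effect n = Pred (Valuation n) 0ℓ

intervene : ∀ {n} → SEM n → Subset n → (Fin n → Bool) → Valuation n
intervene {zero}  f []         α = []
intervene {suc n} f (inX ∷ X) α =
  b ∷ intervene (shiftSEM f b) X (λ i → α (suc i))
  where
  b : Bool
  b = if inX then α zero else f zero []

defaultValuation : ∀ {n} → SEM n → Valuation n
defaultValuation {zero}  f = []
defaultValuation {suc n} f =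
  f zero [] ∷ defaultValuation (shiftSEM f (f zero []))

Breaks : ∀ {n} → SEM n → Effect n → Subset n → Set
Breaks f E X = ∃ λ (α : Fin _ → Bool) → ¬ E (intervene f X α)

ButForCause : ∀ {n} → SEM n → Effect n → Subset n → Set
ButForCause f E X = Breaks f E X × (∀ Y → Y ⊂ X → ¬ Breaks f E Y)

data Act : Set where
  default intervention : Act

applyAct : Act → Bool → Bool
applyAct default      b = b
applyAct intervention b = not b

-- Nodes: a node at level k+1 (k = 0..n) is a valuation of X_1..X_k.
Node : ℕ → Set
Node n = Σ (Fin (suc n)) (λ k → Vec Bool (toℕ k))

root : ∀ {n} → Node n
root = (zero , [])

step : ∀ {n} → SEM n → (i : Fin n) → Vec Bool (toℕ i) → Act → Node n
step f i s a = (suc i , s ∷ʳ applyAct a (f i s))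

-- Labels: true = {intervention}, false = ∅.
label : Act → Bool
label default      = false
label intervention = true

-- A maximal path of the tree is uniquely determined by its sequence of
-- n actions (each node below level n+1 has exactly the two successors
-- default / intervention, which are distinct).
Path : ℕ → Set
Path n = Vec Act n

leaf : ∀ {n} → SEM n → Path n → Valuation n
leaf {zero}  f []       = []
leaf {suc n} f (a ∷ as) = b ∷ leaf (shiftSEM f b) as
  where
  b : Bool
  b = applyAct a (f zero [])

prefix : ∀ {n} → Valuation n → (k : Fin (suc n)) → Vec Bool (toℕ k)
prefix w        zero    = []
prefix (x ∷ w) (suc k) = x ∷ prefix w k

-- The k-th node (k = 0..n; k = 0 is the root) visited by a path.
nodeAt : ∀ {n} → SEM n → Path n → Fin (suc n) → Node n
nodeAt f as k = (k , prefix (leaf f as) k)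

Visits : ∀ {n} → SEM n → Path n → Pred (Node n) 0ℓ → Set
Visits f as C = ∃ λ k → C (nodeAt f as k)

Avoids : ∀ {n} → SEM n → Path n → Pred (Node n) 0ℓ → Set
Avoids f as C = ¬ Visits f as C

-- Reaching ◇E: the leaf of the path lies in E.
Reaches : ∀ {n} → SEM n → Path n → Effect n → Set
Reaches f as E = E (leaf f as)

trace : ∀ {n} → Path n → Vec Bool (suc n)
trace as = false ∷ map label as

hamming : ∀ {m} → Vec Bool m → Vec Bool m → ℕ
hamming []       []       = zero
hamming (x ∷ xs) (y ∷ ys) with x Data.Bool.≟ y
... | Relation.Nullary.yes _ = hamming xs ys
... | Relation.Nullary.no  _ = suc (hamming xs ys)

dHamm : ∀ {n} → Path n → Path n → ℕ
dHamm as bs = hamming (trace as) (trace bs)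

defaultPath : ∀ {n} → Path n
defaultPath = replicate _ default

CounterfactualCause : ∀ {n} → SEM n → (Path n → Path n → ℕ) →
                      Pred (Node n) 0ℓ → Effect n → Path n → Set
CounterfactualCause f d C E π =
  Visits f π C × Reaches f π E ×
  (∃ λ ρ → Avoids f ρ C) ×
  (∀ ρ → Avoids f ρ C →
     (∀ ρ′ → Avoids f ρ′ C → d π ρ ≤ d π ρ′) →
     ¬ Reaches f ρ E)

data C[_,_] {n} (f : SEM n) (X : Subset n) : Node n → Set where
  viaDefault : (i : Fin n) (s : Vec Bool (toℕ i)) → i ∈ X →
               C[ f , X ] (step f i s default)

-- A maximal path is determined by the set of positions where it intervenes, and its Hamming
-- distance to the default path is the size of that set. A path avoids C_X exactly when it
-- intervenes on every variable of X, so the unique closest C_X-avoiding path intervenes on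
-- exactly X. By minimality of the but-for cause X, the breaking intervention α changes the
-- value of every variable of X, so this closest path ends in the broken valuation, outside E.
module Submission where

open import Defs
open import Data.Nat using (ℕ; zero; suc; _≤_; s≤s)
open import Data.Nat.Properties using (≤⇒≯)
open import Data.Bool using (Bool; true; false; not)
open import Data.Fin using (Fin; zero; suc; toℕ)
open import Data.Fin.Subset using (Subset; inside; outside; _∈_; _⊆_; _⊂_; ∣_∣; ⊥)
open import Data.Fin.Subset.Properties
  using (_∈?_; drop-∷-⊆; out⊆; ⊆-antisym; ⊆-reflexive; p⊆q⇒∣p∣≤∣q∣; nonempty?; Empty-unique)
open import Data.Vec using (Vec; []; _∷_; map; lookup; here; there)
open import Data.Vec.Properties
  using (∷-injectiveˡ; ∷-injectiveʳ; ∷ʳ-injective; lookup-map; lookup-replicate; []=⇒lookup; lookup⇒[]=)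
open import Data.Product using (_×_; _,_)
import Data.Product as Product
open import Data.Product.Properties using (Σ-≡,≡←≡)
open import Relation.Nullary using (¬_; yes; no; contradiction)
open import Relation.Binary.PropositionalEquality using (_≡_; refl; sym; trans; cong; cong₂; subst; subst₂)
open import Function using (_∘_)

private
  variable
    n : ℕ
    p q : Subset n
    s : Bool

actionFor : (current target : Bool) → Act
actionFor false false = default
actionFor true  true  = default
actionFor false true  = intervention
actionFor true  false = intervention

applyAct-actionFor : ∀ c b → applyAct (actionFor c b) c ≡ b
applyAct-actionFor false false = refl
applyAct-actionFor true  true  = refl
applyAct-actionFor false true  = refl
applyAct-actionFor true  false = refl

label-actionFor-self : ∀ c → label (actionFor c c) ≡ false
label-actionFor-self false = refl
label-actionFor-self true  = refl

applyAct-fixed⇒default : ∀ {a b} → applyAct a b ≡ b → a ≡ default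
applyAct-fixed⇒default {default}                _  = refl
applyAct-fixed⇒default {intervention} {false} ()
applyAct-fixed⇒default {intervention} {true}  ()

label-injective : ∀ {a b} → label a ≡ label b → a ≡ b
label-injective {default}      {default}      _  = refl
label-injective {intervention} {intervention} _  = refl
label-injective {default}      {intervention} ()
label-injective {intervention} {default}      ()

labels : Path n → Subset n
labels = map label

labels-injective : {ρ σ : Path n} → labels ρ ≡ labels σ → ρ ≡ σ
labels-injective {ρ = []}    {[]}    _  = refl
labels-injective {ρ = _ ∷ _} {_ ∷ _} eq =
  cong₂ _∷_ (label-injective (∷-injectiveˡ eq)) (labels-injective (∷-injectiveʳ eq))

∈-labels⁺ : (ρ : Path n) {i : Fin n} → lookup ρ i ≡ intervention → i ∈ labels ρ
∈-labels⁺ ρ {i} eq = lookup⇒[]= i (labels ρ) (trans (lookup-map i label ρ) (cong label eq))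

∈-labels⁻ : (ρ : Path n) {i : Fin n} → i ∈ labels ρ → lookup ρ i ≡ intervention
∈-labels⁻ ρ {i} i∈ρ =
  label-injective {b = intervention} (trans (sym (lookup-map i label ρ)) ([]=⇒lookup i∈ρ))

∷⊆inside∷ : p ⊆ q → s ∷ p ⊆ inside ∷ q
∷⊆inside∷ p⊆q here        = here
∷⊆inside∷ p⊆q (there x∈p) = there (p⊆q x∈p)

⊆∧⊄⇒≡ : p ⊆ q → ¬ p ⊂ q → p ≡ q
⊆∧⊄⇒≡ {p = p} p⊆q p⊄q = ⊆-antisym p⊆q q⊆p
  where
  q⊆p : _ ⊆ p
  q⊆p {x} x∈q with x ∈? p
  ... | yes x∈p = x∈p
  ... | no  x∉p = contradiction ((λ {y} → p⊆q {y}) , x , x∈q , x∉p) p⊄q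

⊆∧∣∣≥⇒≡ : p ⊆ q → ∣ q ∣ ≤ ∣ p ∣ → p ≡ q
⊆∧∣∣≥⇒≡ {p = []}          {[]}          _   _  = refl
⊆∧∣∣≥⇒≡ {p = outside ∷ p} {outside ∷ q} p⊆q le = cong (outside ∷_) (⊆∧∣∣≥⇒≡ (drop-∷-⊆ p⊆q) le)
⊆∧∣∣≥⇒≡ {p = outside ∷ p} {inside  ∷ q} p⊆q le = contradiction le (≤⇒≯ (p⊆q⇒∣p∣≤∣q∣ (drop-∷-⊆ p⊆q)))
⊆∧∣∣≥⇒≡ {p = inside  ∷ p} {outside ∷ q} p⊆q _  = contradiction (p⊆q here) λ ()
⊆∧∣∣≥⇒≡ {p = inside  ∷ p} {inside  ∷ q} p⊆q (s≤s le) =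
  cong (inside ∷_) (⊆∧∣∣≥⇒≡ (drop-∷-⊆ p⊆q) le)

valuesBefore : SEM n → Path n → (i : Fin n) → Vec Bool (toℕ i)
valuesBefore f (a ∷ ρ) zero    = []
valuesBefore f (a ∷ ρ) (suc i) = b ∷ valuesBefore (shiftSEM f b) ρ i
  where
  b : Bool
  b = applyAct a (f zero [])

nodeAt-suc : (f : SEM n) (ρ : Path n) (i : Fin n) →
             nodeAt f ρ (suc i) ≡ step f i (valuesBefore f ρ i) (lookup ρ i)
nodeAt-suc f (a ∷ ρ) zero    = refl
nodeAt-suc f (a ∷ ρ) (suc i) =
  cong (Product.map suc (applyAct a (f zero []) ∷_)) (nodeAt-suc _ ρ i)

module _ {f : SEM n} {X : Subset n} where

  C-root : {v : Vec Bool 0} → ¬ C[ f , X ] (zero , v)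
  C-root ()

  C-step : ∀ {i s a} → C[ f , X ] (step f i s a) → i ∈ X × a ≡ default
  C-step c = go c refl
    where
    go : ∀ {i s a nd} → C[ f , X ] nd → nd ≡ step f i s a → i ∈ X × a ≡ default
    go (viaDefault j t j∈X) eq with Σ-≡,≡←≡ eq
    ... | refl , eq′ with ∷ʳ-injective t _ eq′
    ... | refl , fixed = j∈X , applyAct-fixed⇒default (sym fixed)

  C-nodeAt⁺ : ∀ {ρ i} → i ∈ X → lookup ρ i ≡ default → C[ f , X ] (nodeAt f ρ (suc i))
  C-nodeAt⁺ {ρ} {i} i∈X eq rewrite nodeAt-suc f ρ i | eq = viaDefault i _ i∈X

  C-nodeAt⁻ : ∀ {ρ i} → C[ f , X ] (nodeAt f ρ (suc i)) → i ∈ X × lookup ρ i ≡ default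
  C-nodeAt⁻ {ρ} {i} c = C-step (subst C[ f , X ] (nodeAt-suc f ρ i) c)

  avoids⇒⊆ : ∀ {ρ} → Avoids f ρ C[ f , X ] → X ⊆ labels ρ
  avoids⇒⊆ {ρ} avoids {i} i∈X with lookup ρ i in eq
  ... | intervention = ∈-labels⁺ ρ eq
  ... | default      = contradiction (suc i , C-nodeAt⁺ i∈X eq) avoids

  ⊆⇒avoids : ∀ {ρ} → X ⊆ labels ρ → Avoids f ρ C[ f , X ]
  ⊆⇒avoids X⊆ρ (zero  , c) = C-root c
  ⊆⇒avoids {ρ} X⊆ρ (suc i , c) with C-nodeAt⁻ c
  ... | i∈X , eq with trans (sym eq) (∈-labels⁻ ρ (X⊆ρ i∈X))
  ... | ()

dHamm-defaultPath : (ρ : Path n) → dHamm defaultPath ρ ≡ ∣ labels ρ ∣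
dHamm-defaultPath []                 = refl
dHamm-defaultPath (default      ∷ ρ) = dHamm-defaultPath ρ
dHamm-defaultPath (intervention ∷ ρ) = cong suc (dHamm-defaultPath ρ)

leaf-defaultPath : (f : SEM n) → leaf f defaultPath ≡ defaultValuation f
leaf-defaultPath {zero}  f = refl
leaf-defaultPath {suc n} f = cong (f zero [] ∷_) (leaf-defaultPath (shiftSEM f (f zero [])))

pathTo : SEM n → Valuation n → Path n
pathTo f []      = []
pathTo f (b ∷ w) = actionFor (f zero []) b ∷ pathTo (shiftSEM f b) w

leaf-pathTo : (f : SEM n) (w : Valuation n) → leaf f (pathTo f w) ≡ w
leaf-pathTo f []      = refl
leaf-pathTo f (b ∷ w) rewrite applyAct-actionFor (f zero []) b =
  cong (b ∷_) (leaf-pathTo (shiftSEM f b) w)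

labels-pathTo-intervene : (f : SEM n) (X : Subset n) (α : Fin n → Bool) →
                          labels (pathTo f (intervene f X α)) ⊆ X
labels-pathTo-intervene f (inside ∷ X) α =
  ∷⊆inside∷ (labels-pathTo-intervene (shiftSEM f (α zero)) X (λ i → α (suc i)))
labels-pathTo-intervene f (outside ∷ X) α rewrite label-actionFor-self (f zero []) =
  out⊆ (labels-pathTo-intervene (shiftSEM f (f zero [])) X (λ i → α (suc i)))

intervene-leaf : (f : SEM n) (ρ : Path n) → intervene f (labels ρ) (lookup (leaf f ρ)) ≡ leaf f ρ
intervene-leaf f []                 = refl
intervene-leaf f (default      ∷ ρ) = cong (f zero [] ∷_) (intervene-leaf _ ρ)
intervene-leaf f (intervention ∷ ρ) = cong (not (f zero []) ∷_) (intervene-leaf _ ρ)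

intervene-⊥ : (f : SEM n) (α : Fin n → Bool) → intervene f ⊥ α ≡ defaultValuation f
intervene-⊥ {zero}  f α = refl
intervene-⊥ {suc n} f α = cong (f zero [] ∷_) (intervene-⊥ (shiftSEM f (f zero [])) (λ i → α (suc i)))

module _ {f : SEM n} (E : Effect n) {X : Subset n} {α : Fin n → Bool} (¬E-w : ¬ E (intervene f X α)) where

  labels-pathTo-breaking : (∀ Y → Y ⊂ X → ¬ Breaks f E Y) → labels (pathTo f (intervene f X α)) ≡ X
  labels-pathTo-breaking minimal = ⊆∧⊄⇒≡ (labels-pathTo-intervene f X α) λ ε⊂X →
    minimal _ ε⊂X (lookup (leaf f ε) , ¬E-w ∘ subst E (trans (intervene-leaf f ε) (leaf-pathTo f _)))
    where
    ε : Path n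
    ε = pathTo f (intervene f X α)

  defaultPath-visits : E (defaultValuation f) → Visits f defaultPath C[ f , X ]
  defaultPath-visits E-default with nonempty? X
  ... | yes (i , i∈X) = suc i , C-nodeAt⁺ i∈X (lookup-replicate i default)
  ... | no  X-empty   = contradiction (subst E (sym w≡default) E-default) ¬E-w
    where
    w≡default : intervene f X α ≡ defaultValuation f
    w≡default = trans (cong (λ Y → intervene f Y α) (Empty-unique X-empty)) (intervene-⊥ f α)

closest-avoiding-unique : {f : SEM n} {X : Subset n} {ρ σ : Path n} → labels σ ≡ X →
                          Avoids f ρ C[ f , X ] → dHamm defaultPath ρ ≤ dHamm defaultPath σ → ρ ≡ σ
closest-avoiding-unique {X = X} {ρ} {σ} σ≡X ρ-avoids ρ≤σ =
  labels-injective (trans (sym (⊆∧∣∣≥⇒≡ (avoids⇒⊆ ρ-avoids) ∣ρ∣≤∣X∣)) (sym σ≡X))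
  where
  ∣ρ∣≤∣X∣ : ∣ labels ρ ∣ ≤ ∣ X ∣
  ∣ρ∣≤∣X∣ = subst₂ _≤_ (dHamm-defaultPath ρ) (trans (dHamm-defaultPath σ) (cong ∣_∣ σ≡X)) ρ≤σ

proposition1 : (n : ℕ) (f : SEM n) (E : Effect n) (X : Subset n) →
    E (defaultValuation f) →
    ButForCause f E X →
    CounterfactualCause f dHamm C[ f , X ] E defaultPath
proposition1 n f E X E-default ((α , ¬E-w) , minimal) =
  defaultPath-visits E ¬E-w E-default , subst E (sym (leaf-defaultPath f)) E-default ,
  (ε , ε-avoids) , closest-misses
  where
  ε : Path n
  ε = pathTo f (intervene f X α)

  labels-ε : labels ε ≡ X
  labels-ε = labels-pathTo-breaking E ¬E-w minimal

  ε-avoids : Avoids f ε C[ f , X ]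
  ε-avoids = ⊆⇒avoids (⊆-reflexive (sym labels-ε))

  closest-misses : ∀ ρ → Avoids f ρ C[ f , X ] →
                   (∀ ρ′ → Avoids f ρ′ C[ f , X ] → dHamm defaultPath ρ ≤ dHamm defaultPath ρ′) →
                   ¬ Reaches f ρ E
  closest-misses ρ ρ-avoids ρ-closest
    rewrite closest-avoiding-unique labels-ε ρ-avoids (ρ-closest ε ε-avoids) =
    ¬E-w ∘ subst E (leaf-pathTo f (intervene f X α))
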